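{- Let $E$ be a finite set and let $\mathbf{M}_1=(E,\mathcal{I}_1)$, $\mathbf{M}_2=(E,\mathcal{I}_2)$ be loopless matroids on $E$ with rank functions $r_1,r_2$, and let $r_{\min}(X)=\min\{r_1(X),r_2(X)\}$. Let $I\in\mathcal{I}_1\cap\mathcal{I}_2$, and let $S_I=\{s\in E\setminus I\mid I+s\in\mathcal{I}_1\}$, $T_I=\{t\in E\setminus I\mid I+t\in\mathcal{I}_2\}$. Let $s^*\in S_I\setminus T_I$ and $t^*\in T_I\setminus S_I$ (so that $r_{\min}(I+s^*)=r_{\min}(I+t^*)=|I|$ and $r_{\min}(I+s^*+t^*)=|I|+1$). Define $S_I^*=\{s\in E\setminus I\mid r_{\min}(I+s+t^*)=|I|+1\}$ and $T_I^*=\{t\in E\setminus I\mid r_{\min}(I+s^*+t)=|I|+1\}$, and \begin{align*} A_1^{\min}[I;s^*,t^*]&=\{(y,s)\mid s\in S_I^*,\,y\in I\}\cup\{(y,t)\mid t\in T_I^*\setminus S_I^*,\,y\in I,\,r_{\min}(I+t-y)=|I|\}\\ &\quad\cup\{(y,x)\mid x\in E\setminus(I\cup S_I^*\cup T_I^*),\,y\in I,\,r_{\min}(I+t^*+x-y)=|I|\},\\ A_2^{\min}[I;s^*,t^*]&=\{(t,y)\mid t\in T_I^*,\,y\in I\}\cup\{(s,y)\mid s\in S_I^*\setminus T_I^*,\,y\in I,\,r_{\min}(I+s-y)=|I|\}\\ &\quad\cup\{(x,y)\mid x\in E\setminus(I\cup S_I^*\cup T_I^*),\,y\in I,\,r_{\min}(I+s^*+x-y)=|I|\},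 \end{align*} and $A^{\min}[I;s^*,t^*]=A_1^{\min}[I;s^*,t^*]\cup A_2^{\min}[I;s^*,t^*]$. Let $A_1[I]=\{(y,x)\mid x\in E\setminus I,\,y\in I,\,I+x-y\in\mathcal{I}_1\}$, $A_2[I]=\{(x,y)\mid x\in E\setminus I,\,y\in I,\,I+x-y\in\mathcal{I}_2\}$ and $A[I]=A_1[I]\cup A_2[I]$. Then: (a) $A_i[I]\subseteq A_i^{\min}[I;s^*,t^*]$ for $i=1,2$; moreover, if $(u,v)\in A^{\min}[I;s^*,t^*]\setminus A[I]$, then $u,v\notin S_I\cup T_I$. (b) If $(y,x)\in A_1^{\min}[I;s^*,t^*]\setminus A_1[I]$, then $(y,t^*)\in A_1[I]$. If $(x,y)\in A_2^{\min}[I;s^*,t^*]\setminus A_2[I]$, then $(s^*,y)\in A_2[I]$.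
   Context: For a set $X$ and element $e$, $X+e=X\cup\{e\}$ and $X-e=X\setminus\{e\}$. Arcs are ordered pairs; $(u,v)$ is an arc from $u$ to $v$. $D[I]=(E\setminus I, I; A[I])$ is the exchangeability graph of $I$, and $(E\setminus I, I; A^{\min}[I;s^*,t^*])$ is the modified exchangeability graph. -}

module Defs where

open import Data.Nat using (ℕ; zero; suc; _<_; _⊔_; _⊓_)
open import Data.Fin using (Fin)
open import Data.Fin.Subset using (Subset; _∈_; _∉_; _⊆_; _∪_; _-_; ⁅_⁆; ∣_∣; ⊥; inside; outside)
open import Data.Fin.Subset.Properties using (_⊆?_)
open import Data.Vec using (_∷_; [])
open import Data.List using (List; []; _∷_; _++_; map; foldr)
open import Data.Bool using (if_then_else_; _∧_)
open import Data.Product using (Σ; _×_; ∃; ∃-syntax)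
open import Data.Sum using (_⊎_)
open import Relation.Nullary using (Dec; ¬_)
open import Relation.Nullary.Decidable using (⌊_⌋)
open import Relation.Binary.PropositionalEquality using (_≡_)

_+ₑ_ : ∀ {n} → Subset n → Fin n → Subset n
X +ₑ e = X ∪ ⁅ e ⁆

record Matroid (n : ℕ) : Set₁ where
  field
    Indep   : Subset n → Set
    indep?  : (X : Subset n) → Dec (Indep X)
    indep-⊥ : Indep ⊥
    indep-⊆ : ∀ {X Y} → X ⊆ Y → Indep Y → Indep X
    indep-aug : ∀ {X Y} → Indep X → Indep Y → ∣ X ∣ < ∣ Y ∣ →
                ∃[ e ] (e ∈ Y × e ∉ X × Indep (X +ₑ e))

open Matroid public

Loopless : ∀ {n} → Matroid n → Set
Loopless M = ∀ e → Indep M ⁅ e ⁆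

allSubsets : (n : ℕ) → List (Subset n)
allSubsets zero    = [] ∷ []
allSubsets (suc n) = map (inside ∷_) (allSubsets n) ++ map (outside ∷_) (allSubsets n)

rank : ∀ {n} → Matroid n → Subset n → ℕ
rank {n} M X =
  foldr _⊔_ 0 (map (λ Y → if ⌊ Y ⊆? X ⌋ ∧ ⌊ indep? M Y ⌋ then ∣ Y ∣ else 0) (allSubsets n))

module Exchange {n : ℕ} (M₁ M₂ : Matroid n) (I : Subset n) (s* t* : Fin n) where

  rmin : Subset n → ℕ
  rmin X = rank M₁ X ⊓ rank M₂ X

  S : Fin n → Set
  S s = s ∉ I × Indep M₁ (I +ₑ s)

  T : Fin n → Set
  T t = t ∉ I × Indep M₂ (I +ₑ t)

  S* : Fin n → Set
  S* s = s ∉ I × rmin ((I +ₑ s) +ₑ t*) ≡ suc ∣ I ∣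

  T* : Fin n → Set
  T* t = t ∉ I × rmin ((I +ₑ s*) +ₑ t) ≡ suc ∣ I ∣

  Rest : Fin n → Set
  Rest x = x ∉ I × ¬ S* x × ¬ T* x

  -- arcs (u , v) are represented by predicates taking u then v
  A₁ : Fin n → Fin n → Set
  A₁ y x = x ∉ I × y ∈ I × Indep M₁ ((I +ₑ x) - y)

  A₂ : Fin n → Fin n → Set
  A₂ x y = x ∉ I × y ∈ I × Indep M₂ ((I +ₑ x) - y)

  A : Fin n → Fin n → Set
  A u v = A₁ u v ⊎ A₂ u v

  A₁min : Fin n → Fin n → Set
  A₁min y v =
      (S* v × y ∈ I)
    ⊎ (T* v × ¬ S* v × y ∈ I × rmin ((I +ₑ v) - y) ≡ ∣ I ∣)
    ⊎ (Rest v × y ∈ I × rmin (((I +ₑ t*) +ₑ v) - y) ≡ ∣ I ∣)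

  A₂min : Fin n → Fin n → Set
  A₂min v y =
      (T* v × y ∈ I)
    ⊎ (S* v × ¬ T* v × y ∈ I × rmin ((I +ₑ v) - y) ≡ ∣ I ∣)
    ⊎ (Rest v × y ∈ I × rmin (((I +ₑ s*) +ₑ v) - y) ≡ ∣ I ∣)

  Amin : Fin n → Fin n → Set
  Amin u v = A₁min u v ⊎ A₂min u v

  NotInST : Fin n → Set
  NotInST u = ¬ (S u ⊎ T u)

module Submission where

-- Since s* ∉ T and t* ∉ S, adding t* to I cannot raise its M₁-rank and adding s* cannot
-- raise its M₂-rank; consequently S* = S and T* = T.  An arc of the first two kinds in
-- A₁min is then an ordinary arc of A₁, because rmin Z = ∣Z∣ forces Z to be independent
-- in both matroids.  For an arc (y, x) of the third kind, r₁(I + t* + x - y) ≥ ∣I∣ lets us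
-- augment I - y from I + t* + x - y, and the new element is t* or x; if (y, x) ∉ A₁ it
-- must be t*, giving the arc (y, t*).

open import Defs
open import Data.Nat using (ℕ; zero; suc; _≤_; _⊓_)
open import Data.Nat.Properties
  using (≤-trans; ≤-reflexive; ≤-antisym; <-≤-trans; ≤⇒≯; ≮⇒≥; n≮n; ⊔-sel;
         m≤n⇒m≤n⊔o; m≤n⇒m≤o⊔n; m⊓n≤m; m⊓n≤n; ⊓-glb; ⊓-idem; m≤n⇒m⊓n≡m; m≥n⇒m⊓n≡n; suc-injective)
open import Data.Fin using (Fin; zero; suc)
open import Data.Fin.Subset using (Subset; _∈_; _∉_; _⊆_; _∪_; _─_; _-_; ⁅_⁆; ∣_∣; ⊥; inside; outside)
open import Data.Fin.Subset.Properties
  using (_∈?_; _⊆?_; ⊆-refl; ⊥⊆; ∣⊥∣≡0; x∈⁅x⁆; x∈⁅y⁆⇒x≡y; p⊆p∪q; q⊆p∪q; x∈p∪q⁻; ∪-assoc; ∪-comm;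
         ∪-identityʳ; p─⊥≡p; p─q⊆p; x∈p∧x≢y⇒x∈p-y; x∈p⇒∣p-x∣<∣p∣; p⊂q⇒∣p∣<∣q∣; p⊆q⇒∣p∣≤∣q∣)
open import Data.Vec.Base using (_∷_; []; here; there)
open import Data.List using (map)
open import Data.List.Properties using (foldr-preservesᵒ)
open import Data.List.Membership.Propositional using () renaming (_∈_ to _∈ₗ_)
open import Data.List.Membership.Propositional.Properties
  using (∈-map⁺; ∈-map⁻; ∈-++⁺ˡ; ∈-++⁺ʳ; foldr-selective)
import Data.List.Relation.Unary.Any as Any
open import Data.Bool using (if_then_else_; _∧_)
open import Data.Product using (_×_; _,_; proj₁; proj₂; ∃-syntax)
open import Data.Sum using (_⊎_; inj₁; inj₂; [_,_]′)
import Data.Sum as Sum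
open import Function using (_∘_)
open import Relation.Nullary using (¬_; yes; no; contradiction)
open import Relation.Nullary.Decidable using (⌊_⌋)
open import Relation.Binary.PropositionalEquality using (_≡_; _≢_; refl; sym; trans; cong; cong₂; module ≡-Reasoning)

private variable
  n : ℕ


x∈p─q⇒x∉q : ∀ {p q : Subset n} {x} → x ∈ p ─ q → x ∉ q
x∈p─q⇒x∉q {p = _ ∷ _} {inside ∷ _} {zero} ()
x∈p─q⇒x∉q {p = _ ∷ _} {outside ∷ _} {zero} _ ()
x∈p─q⇒x∉q {p = _ ∷ _} {_ ∷ _} {suc _} (there x∈p─q) (there x∈q) = x∈p─q⇒x∉q x∈p─q x∈q

x∈p-y⇒x≢y : ∀ {p : Subset n} {x y} → x ∈ p - y → x ≢ y
x∈p-y⇒x≢y {y = y} x∈p-y refl = x∈p─q⇒x∉q x∈p-y (x∈⁅x⁆ y)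

─-mono : ∀ {p q : Subset n} {y} → p ⊆ q → p - y ⊆ q - y
─-mono p⊆q x∈p-y = x∈p∧x≢y⇒x∈p-y (p⊆q (p─q⊆p _ _ x∈p-y)) (x∈p-y⇒x≢y x∈p-y)

p⊆q∧∣q∣≤∣p∣⇒q⊆p : ∀ {p q : Subset n} → p ⊆ q → ∣ q ∣ ≤ ∣ p ∣ → q ⊆ p
p⊆q∧∣q∣≤∣p∣⇒q⊆p {p = p} p⊆q ∣q∣≤∣p∣ {x} x∈q with x ∈? p
... | yes x∈p = x∈p
... | no x∉p  = contradiction (p⊂q⇒∣p∣<∣q∣ (p⊆q , x , x∈q , x∉p)) (≤⇒≯ ∣q∣≤∣p∣)

e∈X+ₑe : ∀ {X : Subset n} {e} → e ∈ X +ₑ e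
e∈X+ₑe {X = X} {e} = q⊆p∪q X ⁅ e ⁆ (x∈⁅x⁆ e)

∈+ₑ⁻ : ∀ {X : Subset n} {e x} → x ∈ X +ₑ e → x ∈ X ⊎ x ≡ e
∈+ₑ⁻ {X = X} {e} x∈X+e = Sum.map₂ (x∈⁅y⁆⇒x≡y e) (x∈p∪q⁻ X ⁅ e ⁆ x∈X+e)

∈+ₑ+ₑ⁻ : ∀ {X : Subset n} {a b x} → x ∈ (X +ₑ a) +ₑ b → x ∉ X → x ≡ a ⊎ x ≡ b
∈+ₑ+ₑ⁻ x∈ x∉X with ∈+ₑ⁻ x∈
... | inj₂ x≡b   = inj₂ x≡b
... | inj₁ x∈X+a = [ (λ x∈X → contradiction x∈X x∉X) , inj₁ ]′ (∈+ₑ⁻ x∈X+a)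

+ₑ-mono : ∀ {X Y : Subset n} {e} → X ⊆ Y → X +ₑ e ⊆ Y +ₑ e
+ₑ-mono X⊆Y x∈X+e with ∈+ₑ⁻ x∈X+e
... | inj₁ x∈X = p⊆p∪q _ (X⊆Y x∈X)
... | inj₂ refl = e∈X+ₑe

+ₑ-comm : ∀ (X : Subset n) a b → (X +ₑ a) +ₑ b ≡ (X +ₑ b) +ₑ a
+ₑ-comm X a b = begin
  (X ∪ ⁅ a ⁆) ∪ ⁅ b ⁆  ≡⟨ ∪-assoc X ⁅ a ⁆ ⁅ b ⁆ ⟩
  X ∪ (⁅ a ⁆ ∪ ⁅ b ⁆)  ≡⟨ cong (X ∪_) (∪-comm ⁅ a ⁆ ⁅ b ⁆) ⟩
  X ∪ (⁅ b ⁆ ∪ ⁅ a ⁆)  ≡⟨ sym (∪-assoc X ⁅ b ⁆ ⁅ a ⁆) ⟩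
  (X ∪ ⁅ b ⁆) ∪ ⁅ a ⁆  ∎
  where open ≡-Reasoning

+ₑ-─-swap : ∀ {X : Subset n} {a y} → (X +ₑ a) - y ⊆ (X - y) +ₑ a
+ₑ-─-swap x∈X+a-y with ∈+ₑ⁻ (p─q⊆p _ _ x∈X+a-y)
... | inj₁ x∈X = p⊆p∪q _ (x∈p∧x≢y⇒x∈p-y x∈X (x∈p-y⇒x≢y x∈X+a-y))
... | inj₂ refl = e∈X+ₑe

x∉X⇒∣X+ₑx∣≡1+∣X∣ : ∀ {X : Subset n} {x} → x ∉ X → ∣ X +ₑ x ∣ ≡ suc ∣ X ∣
x∉X⇒∣X+ₑx∣≡1+∣X∣ {X = inside ∷ X}  {zero}  x∉X = contradiction here x∉X
x∉X⇒∣X+ₑx∣≡1+∣X∣ {X = outside ∷ X} {zero}  _   = cong (suc ∘ ∣_∣) (∪-identityʳ X)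
x∉X⇒∣X+ₑx∣≡1+∣X∣ {X = inside ∷ X}  {suc x} x∉X = cong suc (x∉X⇒∣X+ₑx∣≡1+∣X∣ (x∉X ∘ there))
x∉X⇒∣X+ₑx∣≡1+∣X∣ {X = outside ∷ X} {suc x} x∉X = x∉X⇒∣X+ₑx∣≡1+∣X∣ (x∉X ∘ there)

y∈X⇒1+∣X-y∣≡∣X∣ : ∀ {X : Subset n} {y} → y ∈ X → suc ∣ X - y ∣ ≡ ∣ X ∣
y∈X⇒1+∣X-y∣≡∣X∣ {X = inside ∷ X}  {zero}  here        = cong (suc ∘ ∣_∣) (p─⊥≡p X)
y∈X⇒1+∣X-y∣≡∣X∣ {X = inside ∷ X}  {suc y} (there y∈X) = cong suc (y∈X⇒1+∣X-y∣≡∣X∣ y∈X)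
y∈X⇒1+∣X-y∣≡∣X∣ {X = outside ∷ X} {suc y} (there y∈X) = y∈X⇒1+∣X-y∣≡∣X∣ y∈X

∣X+ₑx-y∣≡∣X∣ : ∀ {X : Subset n} {x y} → x ∉ X → y ∈ X → ∣ (X +ₑ x) - y ∣ ≡ ∣ X ∣
∣X+ₑx-y∣≡∣X∣ x∉X y∈X =
  suc-injective (trans (y∈X⇒1+∣X-y∣≡∣X∣ (p⊆p∪q _ y∈X)) (x∉X⇒∣X+ₑx∣≡1+∣X∣ x∉X))

∈-allSubsets : (Y : Subset n) → Y ∈ₗ allSubsets n
∈-allSubsets []            = Any.here refl
∈-allSubsets (inside ∷ Y)  = ∈-++⁺ˡ (∈-map⁺ (inside ∷_) (∈-allSubsets Y))
∈-allSubsets (outside ∷ Y) = ∈-++⁺ʳ _ (∈-map⁺ (outside ∷_) (∈-allSubsets Y))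

module _ (M : Matroid n) where

  candidate : Subset n → Subset n → ℕ
  candidate X Y = if ⌊ Y ⊆? X ⌋ ∧ ⌊ indep? M Y ⌋ then ∣ Y ∣ else 0

  candidate-indep : ∀ {X Y} → Y ⊆ X → Indep M Y → candidate X Y ≡ ∣ Y ∣
  candidate-indep {X} {Y} Y⊆X Y∈ℐ with Y ⊆? X | indep? M Y
  ... | yes _    | yes _    = refl
  ... | no Y⊈X   | _        = contradiction (λ {x} → Y⊆X {x}) Y⊈X
  ... | yes _    | no Y∉ℐ   = contradiction Y∈ℐ Y∉ℐ

  candidate-cases : ∀ X Y → candidate X Y ≡ 0 ⊎ (Y ⊆ X × Indep M Y × candidate X Y ≡ ∣ Y ∣)
  candidate-cases X Y with Y ⊆? X | indep? M Y
  ... | yes Y⊆X | yes Y∈ℐ = inj₂ (Y⊆X , Y∈ℐ , refl)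
  ... | yes _   | no _    = inj₁ refl
  ... | no _    | _       = inj₁ refl

  indep⊆⇒∣Y∣≤rank : ∀ {X Y} → Y ⊆ X → Indep M Y → ∣ Y ∣ ≤ rank M X
  indep⊆⇒∣Y∣≤rank {X} {Y} Y⊆X Y∈ℐ =
    foldr-preservesᵒ (λ a b → [ m≤n⇒m≤n⊔o b , m≤n⇒m≤o⊔n a ]′) 0 (map (candidate X) (allSubsets n))
      (inj₂ (Any.map (λ c≡ → ≤-reflexive (trans (sym (candidate-indep Y⊆X Y∈ℐ)) c≡))
                     (∈-map⁺ (candidate X) (∈-allSubsets Y))))

  rank-attained : ∀ X → ∃[ Y ] (Y ⊆ X × Indep M Y × rank M X ≡ ∣ Y ∣)
  rank-attained X = from-selective (foldr-selective ⊔-sel 0 (map (candidate X) (allSubsets n)))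
    where
      Attained : Set
      Attained = ∃[ Y ] (Y ⊆ X × Indep M Y × rank M X ≡ ∣ Y ∣)

      by-⊥ : rank M X ≡ 0 → Attained
      by-⊥ r≡0 = ⊥ , ⊥⊆ , indep-⊥ M , trans r≡0 (sym (∣⊥∣≡0 n))

      by-candidate : ∀ Y → rank M X ≡ candidate X Y → Attained
      by-candidate Y r≡c with candidate-cases X Y
      ... | inj₁ c≡0 = by-⊥ (trans r≡c c≡0)
      ... | inj₂ (Y⊆X , Y∈ℐ , c≡∣Y∣) = Y , Y⊆X , Y∈ℐ , trans r≡c c≡∣Y∣

      from-selective : rank M X ≡ 0 ⊎ rank M X ∈ₗ map (candidate X) (allSubsets n) → Attained
      from-selective (inj₁ r≡0) = by-⊥ r≡0
      from-selective (inj₂ r∈)  = let Y , _ , r≡c = ∈-map⁻ (candidate X) r∈ in by-candidate Y r≡c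

  rank≤∣X∣ : ∀ X → rank M X ≤ ∣ X ∣
  rank≤∣X∣ X with rank-attained X
  ... | Y , Y⊆X , _ , r≡∣Y∣ = ≤-trans (≤-reflexive r≡∣Y∣) (p⊆q⇒∣p∣≤∣q∣ Y⊆X)

  rank-indep : ∀ {X} → Indep M X → rank M X ≡ ∣ X ∣
  rank-indep {X} X∈ℐ = ≤-antisym (rank≤∣X∣ X) (indep⊆⇒∣Y∣≤rank ⊆-refl X∈ℐ)

  ∣X∣≤rank⇒indep : ∀ {X} → ∣ X ∣ ≤ rank M X → Indep M X
  ∣X∣≤rank⇒indep {X} ∣X∣≤r with rank-attained X
  ... | Y , Y⊆X , Y∈ℐ , r≡∣Y∣ =
    indep-⊆ M (p⊆q∧∣q∣≤∣p∣⇒q⊆p Y⊆X (≤-trans ∣X∣≤r (≤-reflexive r≡∣Y∣))) Y∈ℐ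

  unextendable⇒rank≤∣J∣ : ∀ {J X} → Indep M J →
                           (∀ {e} → e ∈ X → e ∉ J → ¬ Indep M (J +ₑ e)) → rank M X ≤ ∣ J ∣
  unextendable⇒rank≤∣J∣ {J} {X} J∈ℐ unextendable with rank-attained X
  ... | Y , Y⊆X , Y∈ℐ , r≡∣Y∣ = ≮⇒≥ λ ∣J∣<r →
    let e , e∈Y , e∉J , J+e∈ℐ = indep-aug M J∈ℐ Y∈ℐ (≤-trans ∣J∣<r (≤-reflexive r≡∣Y∣))
    in unextendable (Y⊆X e∈Y) e∉J J+e∈ℐ

  ⊆J+a+b⇒rank≤∣J∣ : ∀ {J X a b} → Indep M J → ¬ Indep M (J +ₑ a) → ¬ Indep M (J +ₑ b) →
                     X ⊆ (J +ₑ a) +ₑ b → rank M X ≤ ∣ J ∣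
  ⊆J+a+b⇒rank≤∣J∣ {J} {X} {a} {b} J∈ℐ J+a∉ℐ J+b∉ℐ X⊆ =
    unextendable⇒rank≤∣J∣ J∈ℐ (λ e∈X e∉J → J+e∉ℐ (∈+ₑ+ₑ⁻ (X⊆ e∈X) e∉J))
    where
      J+e∉ℐ : ∀ {e} → e ≡ a ⊎ e ≡ b → ¬ Indep M (J +ₑ e)
      J+e∉ℐ (inj₁ refl) = J+a∉ℐ
      J+e∉ℐ (inj₂ refl) = J+b∉ℐ

  rank[J+a]≡∣J∣ : ∀ {J a} → Indep M J → ¬ Indep M (J +ₑ a) → rank M (J +ₑ a) ≡ ∣ J ∣
  rank[J+a]≡∣J∣ J∈ℐ J+a∉ℐ =
    ≤-antisym (⊆J+a+b⇒rank≤∣J∣ J∈ℐ J+a∉ℐ J+a∉ℐ (p⊆p∪q _)) (indep⊆⇒∣Y∣≤rank (p⊆p∪q _) J∈ℐ)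

  exchange-into-pair : ∀ {J a b y} → Indep M J → y ∈ J → ∣ J ∣ ≤ rank M (((J +ₑ a) +ₑ b) - y) →
                       Indep M ((J +ₑ a) - y) ⊎ Indep M ((J +ₑ b) - y)
  exchange-into-pair {J} {a} {b} {y} J∈ℐ y∈J ∣J∣≤r with rank-attained (((J +ₑ a) +ₑ b) - y)
  ... | Y , Y⊆ , Y∈ℐ , r≡∣Y∣
    with indep-aug M (indep-⊆ M (p─q⊆p _ _) J∈ℐ) Y∈ℐ
           (<-≤-trans (x∈p⇒∣p-x∣<∣p∣ y∈J) (≤-trans ∣J∣≤r (≤-reflexive r≡∣Y∣)))
  ... | e , e∈Y , e∉J-y , J-y+e∈ℐ = Sum.map J+e-y∈ℐ J+e-y∈ℐ (∈+ₑ+ₑ⁻ (p─q⊆p _ _ (Y⊆ e∈Y)) e∉J)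
    where
      e∉J : e ∉ J
      e∉J e∈J = e∉J-y (x∈p∧x≢y⇒x∈p-y e∈J (x∈p-y⇒x≢y (Y⊆ e∈Y)))

      J+e-y∈ℐ : ∀ {c} → e ≡ c → Indep M ((J +ₑ c) - y)
      J+e-y∈ℐ refl = indep-⊆ M +ₑ-─-swap J-y+e∈ℐ

module _ (M₁ M₂ : Matroid n) {X : Subset n} where

  rank⊓rank≡∣X∣⇒indep : rank M₁ X ⊓ rank M₂ X ≡ ∣ X ∣ → Indep M₁ X × Indep M₂ X
  rank⊓rank≡∣X∣⇒indep r≡∣X∣ =
    ∣X∣≤rank⇒indep M₁ (≤-trans (≤-reflexive (sym r≡∣X∣)) (m⊓n≤m _ _)) ,
    ∣X∣≤rank⇒indep M₂ (≤-trans (≤-reflexive (sym r≡∣X∣)) (m⊓n≤n _ _))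

  indep⇒rank⊓rank≡∣X∣ : Indep M₁ X → Indep M₂ X → rank M₁ X ⊓ rank M₂ X ≡ ∣ X ∣
  indep⇒rank⊓rank≡∣X∣ X∈ℐ₁ X∈ℐ₂ = trans (cong₂ _⊓_ (rank-indep M₁ X∈ℐ₁) (rank-indep M₂ X∈ℐ₂)) (⊓-idem _)

module ExchangeProperties (M₁ M₂ : Matroid n) (I : Subset n) (I∈ℐ₁ : Indep M₁ I) (I∈ℐ₂ : Indep M₂ I)
  (s* t* : Fin n)
  (s*∈S : Exchange.S M₁ M₂ I s* t* s*) (s*∉T : ¬ Exchange.T M₁ M₂ I s* t* s*)
  (t*∈T : Exchange.T M₁ M₂ I s* t* t*) (t*∉S : ¬ Exchange.S M₁ M₂ I s* t* t*) where

  open Exchange M₁ M₂ I s* t*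

  I+t*∉ℐ₁ : ¬ Indep M₁ (I +ₑ t*)
  I+t*∉ℐ₁ I+t*∈ℐ₁ = t*∉S (proj₁ t*∈T , I+t*∈ℐ₁)

  I+s*∉ℐ₂ : ¬ Indep M₂ (I +ₑ s*)
  I+s*∉ℐ₂ I+s*∈ℐ₂ = s*∉T (proj₁ s*∈S , I+s*∈ℐ₂)

  S⊆S* : ∀ {v} → S v → S* v
  S⊆S* {v} (v∉I , I+v∈ℐ₁) = v∉I , (begin
    rmin X                ≡⟨ m≤n⇒m⊓n≡m (≤-trans (≤-reflexive r₁≡) 1+∣I∣≤r₂) ⟩
    rank M₁ X             ≡⟨ r₁≡ ⟩
    suc ∣ I ∣             ∎)
    where
      open ≡-Reasoning
      X : Subset n
      X = (I +ₑ v) +ₑ t*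
      r₁≡ : rank M₁ X ≡ suc ∣ I ∣
      r₁≡ = trans (rank[J+a]≡∣J∣ M₁ I+v∈ℐ₁ (I+t*∉ℐ₁ ∘ indep-⊆ M₁ (+ₑ-mono (p⊆p∪q _))))
                  (x∉X⇒∣X+ₑx∣≡1+∣X∣ v∉I)
      1+∣I∣≤r₂ : suc ∣ I ∣ ≤ rank M₂ X
      1+∣I∣≤r₂ = ≤-trans (≤-reflexive (sym (x∉X⇒∣X+ₑx∣≡1+∣X∣ (proj₁ t*∈T))))
                       (indep⊆⇒∣Y∣≤rank M₂ (+ₑ-mono (p⊆p∪q _)) (proj₂ t*∈T))

  T⊆T* : ∀ {v} → T v → T* v
  T⊆T* {v} (v∉I , I+v∈ℐ₂) = v∉I , (begin
    rmin X                ≡⟨ m≥n⇒m⊓n≡n (≤-trans (≤-reflexive r₂≡) 1+∣I∣≤r₁) ⟩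
    rank M₂ X             ≡⟨ r₂≡ ⟩
    suc ∣ I ∣             ∎)
    where
      open ≡-Reasoning
      X : Subset n
      X = (I +ₑ s*) +ₑ v
      r₂≡ : rank M₂ X ≡ suc ∣ I ∣
      r₂≡ = begin
        rank M₂ ((I +ₑ s*) +ₑ v)  ≡⟨ cong (rank M₂) (+ₑ-comm I s* v) ⟩
        rank M₂ ((I +ₑ v) +ₑ s*)  ≡⟨ rank[J+a]≡∣J∣ M₂ I+v∈ℐ₂ (I+s*∉ℐ₂ ∘ indep-⊆ M₂ (+ₑ-mono (p⊆p∪q _))) ⟩
        ∣ I +ₑ v ∣                ≡⟨ x∉X⇒∣X+ₑx∣≡1+∣X∣ v∉I ⟩
        suc ∣ I ∣                 ∎
      1+∣I∣≤r₁ : suc ∣ I ∣ ≤ rank M₁ X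
      1+∣I∣≤r₁ = ≤-trans (≤-reflexive (sym (x∉X⇒∣X+ₑx∣≡1+∣X∣ (proj₁ s*∈S))))
                       (indep⊆⇒∣Y∣≤rank M₁ (p⊆p∪q _) (proj₂ s*∈S))

  S*⊆S : ∀ {v} → S* v → S v
  S*⊆S {v} (v∉I , rmin≡) with indep? M₁ (I +ₑ v)
  ... | yes I+v∈ℐ₁ = v∉I , I+v∈ℐ₁
  ... | no I+v∉ℐ₁  = contradiction
    (≤-trans (≤-trans (≤-reflexive (sym rmin≡)) (m⊓n≤m _ _))
             (⊆J+a+b⇒rank≤∣J∣ M₁ I∈ℐ₁ I+v∉ℐ₁ I+t*∉ℐ₁ ⊆-refl))
    (n≮n ∣ I ∣)

  T*⊆T : ∀ {v} → T* v → T v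
  T*⊆T {v} (v∉I , rmin≡) with indep? M₂ (I +ₑ v)
  ... | yes I+v∈ℐ₂ = v∉I , I+v∈ℐ₂
  ... | no I+v∉ℐ₂  = contradiction
    (≤-trans (≤-trans (≤-reflexive (sym rmin≡)) (m⊓n≤n _ _))
             (⊆J+a+b⇒rank≤∣J∣ M₂ I∈ℐ₂ I+s*∉ℐ₂ I+v∉ℐ₂ ⊆-refl))
    (n≮n ∣ I ∣)

  rmin≡∣I∣⇒indep : ∀ {x y} → x ∉ I → y ∈ I → rmin ((I +ₑ x) - y) ≡ ∣ I ∣ →
                   Indep M₁ ((I +ₑ x) - y) × Indep M₂ ((I +ₑ x) - y)
  rmin≡∣I∣⇒indep x∉I y∈I rmin≡ = rank⊓rank≡∣X∣⇒indep M₁ M₂ (trans rmin≡ (sym (∣X+ₑx-y∣≡∣X∣ x∉I y∈I)))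

  indep⇒rmin≡∣I∣ : ∀ {x y} → x ∉ I → y ∈ I → Indep M₁ ((I +ₑ x) - y) → Indep M₂ ((I +ₑ x) - y) →
                   rmin ((I +ₑ x) - y) ≡ ∣ I ∣
  indep⇒rmin≡∣I∣ x∉I y∈I Z∈ℐ₁ Z∈ℐ₂ = trans (indep⇒rank⊓rank≡∣X∣ M₁ M₂ Z∈ℐ₁ Z∈ℐ₂) (∣X+ₑx-y∣≡∣X∣ x∉I y∈I)

  rmin[I+t*+x-y]≡∣I∣ : ∀ {x y} → x ∉ I → y ∈ I → Indep M₁ ((I +ₑ x) - y) → ¬ Indep M₁ (I +ₑ x) →
                       rmin (((I +ₑ t*) +ₑ x) - y) ≡ ∣ I ∣
  rmin[I+t*+x-y]≡∣I∣ x∉I y∈I I+x-y∈ℐ₁ I+x∉ℐ₁ = ≤-antisym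
    (≤-trans (m⊓n≤m _ _) (⊆J+a+b⇒rank≤∣J∣ M₁ I∈ℐ₁ I+t*∉ℐ₁ I+x∉ℐ₁ (p─q⊆p _ _)))
    (⊓-glb (≤-trans (≤-reflexive (sym (∣X+ₑx-y∣≡∣X∣ x∉I y∈I)))
                    (indep⊆⇒∣Y∣≤rank M₁ (─-mono (+ₑ-mono (p⊆p∪q _))) I+x-y∈ℐ₁))
           (≤-trans (≤-reflexive (sym (∣X+ₑx-y∣≡∣X∣ (proj₁ t*∈T) y∈I)))
                    (indep⊆⇒∣Y∣≤rank M₂ (─-mono (p⊆p∪q _)) (indep-⊆ M₂ (p─q⊆p _ _) (proj₂ t*∈T)))))

  rmin[I+s*+x-y]≡∣I∣ : ∀ {x y} → x ∉ I → y ∈ I → Indep M₂ ((I +ₑ x) - y) → ¬ Indep M₂ (I +ₑ x) →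
                       rmin (((I +ₑ s*) +ₑ x) - y) ≡ ∣ I ∣
  rmin[I+s*+x-y]≡∣I∣ x∉I y∈I I+x-y∈ℐ₂ I+x∉ℐ₂ = ≤-antisym
    (≤-trans (m⊓n≤n _ _) (⊆J+a+b⇒rank≤∣J∣ M₂ I∈ℐ₂ I+s*∉ℐ₂ I+x∉ℐ₂ (p─q⊆p _ _)))
    (⊓-glb (≤-trans (≤-reflexive (sym (∣X+ₑx-y∣≡∣X∣ (proj₁ s*∈S) y∈I)))
                    (indep⊆⇒∣Y∣≤rank M₁ (─-mono (p⊆p∪q _)) (indep-⊆ M₁ (p─q⊆p _ _) (proj₂ s*∈S))))
           (≤-trans (≤-reflexive (sym (∣X+ₑx-y∣≡∣X∣ x∉I y∈I)))
                    (indep⊆⇒∣Y∣≤rank M₂ (─-mono (+ₑ-mono (p⊆p∪q _))) I+x-y∈ℐ₂)))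

  A₁⊆A₁min : ∀ y x → A₁ y x → A₁min y x
  A₁⊆A₁min y x (x∉I , y∈I , I+x-y∈ℐ₁) with indep? M₁ (I +ₑ x) | indep? M₂ (I +ₑ x)
  ... | yes I+x∈ℐ₁ | _ = inj₁ (S⊆S* (x∉I , I+x∈ℐ₁) , y∈I)
  ... | no I+x∉ℐ₁ | yes I+x∈ℐ₂ = inj₂ (inj₁ (T⊆T* (x∉I , I+x∈ℐ₂) , I+x∉ℐ₁ ∘ proj₂ ∘ S*⊆S , y∈I ,
    indep⇒rmin≡∣I∣ x∉I y∈I I+x-y∈ℐ₁ (indep-⊆ M₂ (p─q⊆p _ _) I+x∈ℐ₂)))
  ... | no I+x∉ℐ₁ | no I+x∉ℐ₂ = inj₂ (inj₂ ((x∉I , I+x∉ℐ₁ ∘ proj₂ ∘ S*⊆S , I+x∉ℐ₂ ∘ proj₂ ∘ T*⊆T) , y∈I ,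
    rmin[I+t*+x-y]≡∣I∣ x∉I y∈I I+x-y∈ℐ₁ I+x∉ℐ₁))

  A₂⊆A₂min : ∀ x y → A₂ x y → A₂min x y
  A₂⊆A₂min x y (x∉I , y∈I , I+x-y∈ℐ₂) with indep? M₂ (I +ₑ x) | indep? M₁ (I +ₑ x)
  ... | yes I+x∈ℐ₂ | _ = inj₁ (T⊆T* (x∉I , I+x∈ℐ₂) , y∈I)
  ... | no I+x∉ℐ₂ | yes I+x∈ℐ₁ = inj₂ (inj₁ (S⊆S* (x∉I , I+x∈ℐ₁) , I+x∉ℐ₂ ∘ proj₂ ∘ T*⊆T , y∈I ,
    indep⇒rmin≡∣I∣ x∉I y∈I (indep-⊆ M₁ (p─q⊆p _ _) I+x∈ℐ₁) I+x-y∈ℐ₂))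
  ... | no I+x∉ℐ₂ | no I+x∉ℐ₁ = inj₂ (inj₂ ((x∉I , I+x∉ℐ₁ ∘ proj₂ ∘ S*⊆S , I+x∉ℐ₂ ∘ proj₂ ∘ T*⊆T) , y∈I ,
    rmin[I+s*+x-y]≡∣I∣ x∉I y∈I I+x-y∈ℐ₂ I+x∉ℐ₂))

  A₁min⇒A₁⊎Rest : ∀ {y x} → A₁min y x → A₁ y x ⊎ (Rest x × y ∈ I × rmin (((I +ₑ t*) +ₑ x) - y) ≡ ∣ I ∣)
  A₁min⇒A₁⊎Rest (inj₁ (x∈S* , y∈I)) =
    let x∉I , I+x∈ℐ₁ = S*⊆S x∈S* in inj₁ (x∉I , y∈I , indep-⊆ M₁ (p─q⊆p _ _) I+x∈ℐ₁)
  A₁min⇒A₁⊎Rest (inj₂ (inj₁ ((x∉I , _) , _ , y∈I , rmin≡))) =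
    inj₁ (x∉I , y∈I , proj₁ (rmin≡∣I∣⇒indep x∉I y∈I rmin≡))
  A₁min⇒A₁⊎Rest (inj₂ (inj₂ rest)) = inj₂ rest

  A₂min⇒A₂⊎Rest : ∀ {x y} → A₂min x y → A₂ x y ⊎ (Rest x × y ∈ I × rmin (((I +ₑ s*) +ₑ x) - y) ≡ ∣ I ∣)
  A₂min⇒A₂⊎Rest (inj₁ (x∈T* , y∈I)) =
    let x∉I , I+x∈ℐ₂ = T*⊆T x∈T* in inj₁ (x∉I , y∈I , indep-⊆ M₂ (p─q⊆p _ _) I+x∈ℐ₂)
  A₂min⇒A₂⊎Rest (inj₂ (inj₁ ((x∉I , _) , _ , y∈I , rmin≡))) =
    inj₁ (x∉I , y∈I , proj₂ (rmin≡∣I∣⇒indep x∉I y∈I rmin≡))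
  A₂min⇒A₂⊎Rest (inj₂ (inj₂ rest)) = inj₂ rest

  ∈I⇒NotInST : ∀ {y} → y ∈ I → NotInST y
  ∈I⇒NotInST y∈I = [ (λ y∈S → proj₁ y∈S y∈I) , (λ y∈T → proj₁ y∈T y∈I) ]′

  Rest⇒NotInST : ∀ {x} → Rest x → NotInST x
  Rest⇒NotInST (_ , x∉S* , x∉T*) = [ x∉S* ∘ S⊆S* , x∉T* ∘ T⊆T* ]′

  Amin∖A⇒NotInST : ∀ u v → Amin u v → ¬ A u v → NotInST u × NotInST v
  Amin∖A⇒NotInST u v (inj₁ arc) ¬A with A₁min⇒A₁⊎Rest arc
  ... | inj₁ u→v∈A₁ = contradiction (inj₁ u→v∈A₁) ¬A
  ... | inj₂ (v∈Rest , u∈I , _) = ∈I⇒NotInST u∈I , Rest⇒NotInST v∈Rest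
  Amin∖A⇒NotInST u v (inj₂ arc) ¬A with A₂min⇒A₂⊎Rest arc
  ... | inj₁ u→v∈A₂ = contradiction (inj₂ u→v∈A₂) ¬A
  ... | inj₂ (u∈Rest , v∈I , _) = Rest⇒NotInST u∈Rest , ∈I⇒NotInST v∈I

  A₁min∖A₁⇒A₁[y,t*] : ∀ y x → A₁min y x → ¬ A₁ y x → A₁ y t*
  A₁min∖A₁⇒A₁[y,t*] y x arc ¬A₁ with A₁min⇒A₁⊎Rest arc
  ... | inj₁ y→x∈A₁ = contradiction y→x∈A₁ ¬A₁
  ... | inj₂ ((x∉I , _) , y∈I , rmin≡) =
    [ (λ I+t*-y∈ℐ₁ → proj₁ t*∈T , y∈I , I+t*-y∈ℐ₁) , (λ I+x-y∈ℐ₁ → contradiction (x∉I , y∈I , I+x-y∈ℐ₁) ¬A₁) ]′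
      (exchange-into-pair M₁ I∈ℐ₁ y∈I (≤-trans (≤-reflexive (sym rmin≡)) (m⊓n≤m _ _)))

  A₂min∖A₂⇒A₂[s*,y] : ∀ x y → A₂min x y → ¬ A₂ x y → A₂ s* y
  A₂min∖A₂⇒A₂[s*,y] x y arc ¬A₂ with A₂min⇒A₂⊎Rest arc
  ... | inj₁ x→y∈A₂ = contradiction x→y∈A₂ ¬A₂
  ... | inj₂ ((x∉I , _) , y∈I , rmin≡) =
    [ (λ I+s*-y∈ℐ₂ → proj₁ s*∈S , y∈I , I+s*-y∈ℐ₂) , (λ I+x-y∈ℐ₂ → contradiction (x∉I , y∈I , I+x-y∈ℐ₂) ¬A₂) ]′
      (exchange-into-pair M₂ I∈ℐ₂ y∈I (≤-trans (≤-reflexive (sym rmin≡)) (m⊓n≤n _ _)))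

lemma3p3 : {n : ℕ} (M₁ M₂ : Matroid n) → Loopless M₁ → Loopless M₂ →
    (I : Subset n) → Indep M₁ I → Indep M₂ I →
    (s* t* : Fin n) →
    Exchange.S M₁ M₂ I s* t* s* → ¬ Exchange.T M₁ M₂ I s* t* s* →
    Exchange.T M₁ M₂ I s* t* t* → ¬ Exchange.S M₁ M₂ I s* t* t* →
    let open Exchange M₁ M₂ I s* t* in
    ((∀ u v → A₁ u v → A₁min u v)
     × (∀ u v → A₂ u v → A₂min u v)
     × (∀ u v → Amin u v → ¬ A u v → NotInST u × NotInST v))
    × (∀ y x → A₁min y x → ¬ A₁ y x → A₁ y t*)
    × (∀ x y → A₂min x y → ¬ A₂ x y → A₂ s* y)
lemma3p3 M₁ M₂ _ _ I I∈ℐ₁ I∈ℐ₂ s* t* s*∈S s*∉T t*∈T t*∉S =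
  (A₁⊆A₁min , A₂⊆A₂min , Amin∖A⇒NotInST) , A₁min∖A₁⇒A₁[y,t*] , A₂min∖A₂⇒A₂[s*,y]
  where open ExchangeProperties M₁ M₂ I I∈ℐ₁ I∈ℐ₂ s* t* s*∈S s*∉T t*∈T t*∉S
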